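{- Consider the MILP instance $\min\{\mathbf{c}\mathbf{x}\mid A\mathbf{x}=\mathbf{b},\ \mathbf{l}\le\mathbf{x}\le\mathbf{u},\ \mathbf{x}\in\mathbb{Z}^z\times\mathbb{Q}^q\}$ with $A=(A_{\mathbb{Z}}\ A_{\mathbb{Q}})\in\mathbb{Z}^{m\times(z+q)}$, $\mathbf{l},\mathbf{u},\mathbf{c}\in\mathbb{Z}^{z+q}$, $\mathbf{b}\in\mathbb{Z}^m$, split as $\mathbf{x}=(\mathbf{x}_{\mathbb{Z}},\mathbf{x}_{\mathbb{Q}})$, $\mathbf{c}=(\mathbf{c}_{\mathbb{Z}},\mathbf{c}_{\mathbb{Q}})$ etc. Suppose it has fractionality $M$ and let $\tilde M:=M!$. Consider the integer program $$\min\{(\tilde M\mathbf{c}_{\mathbb{Z}},\mathbf{c}_{\mathbb{Q}})\mathbf{z}\mid (\tilde M A_{\mathbb{Z}}\ \ A_{\mathbb{Q}})\mathbf{z}=\tilde M\mathbf{b},\ (\mathbf{l}_{\mathbb{Z}},\tilde M\mathbf{l}_{\mathbb{Q}})\le(\mathbf{z}_{\mathbb{Z}},\mathbf{z}_{\mathbb{Q}})\le(\mathbf{u}_{\mathbb{Z}},\tilde M\mathbf{u}_{\mathbb{Q}}),\ \mathbf{z}\in\mathbb{Z}^{z+q}\}.$$ If $(\mathbf{z}_{\mathbb{Z}},\mathbf{z}_{\mathbb{Q}})$ is an optimum of this integer program, then $\mathbf{x}=(\mathbf{z}_{\mathbb{Z}},\frac{1}{\tilde M}\mathbf{z}_{\mathbb{Q}})$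 is an optimum of the MILP instance.
   Context: The fractionality of an MILP instance that has an optimal solution is the minimum, over all optimal solutions $\mathbf{x}$, of the largest denominator (in lowest terms) among the entries of $\mathbf{x}_{\mathbb{Q}}$. -}

module Defs where

open import Data.Nat as ℕ using (ℕ; zero; suc; _⊔_; _!)
open import Data.Nat.Properties using (_!≢0)
open import Data.Integer as ℤ using (ℤ)
open import Data.Rational as ℚ using (ℚ; _/_)
open import Data.Fin using (Fin; zero; suc)
open import Data.Product using (Σ; _×_; _,_; proj₂)
open import Relation.Binary.PropositionalEquality using (_≡_)

Σℤ : ∀ {n} → (Fin n → ℤ) → ℤ
Σℤ {zero}  f = ℤ.0ℤ
Σℤ {suc n} f = f zero ℤ.+ Σℤ (λ i → f (suc i))

Σℚ : ∀ {n} → (Fin n → ℚ) → ℚ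
Σℚ {zero}  f = ℚ.0ℚ
Σℚ {suc n} f = f zero ℚ.+ Σℚ (λ i → f (suc i))

maxDen : ∀ {n} → (Fin n → ℚ) → ℕ
maxDen {zero}  f = 1
maxDen {suc n} f = ℚ.denominatorℕ (f zero) ⊔ maxDen (λ i → f (suc i))

record MILP (m z q : ℕ) : Set where
  field
    Az : Fin m → Fin z → ℤ
    Aq : Fin m → Fin q → ℤ
    b  : Fin m → ℤ
    lz uz cz : Fin z → ℤ
    lq uq cq : Fin q → ℤ

module _ {m z q : ℕ} (P : MILP m z q) where
  open MILP P

  Sol : Set
  Sol = (Fin z → ℤ) × (Fin q → ℚ)

  Feasible : Sol → Set
  Feasible (xz , xq) =
    (∀ i → Σℚ (λ j → (Az i j ℚ./ 1) ℚ.* (xz j ℚ./ 1))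
             ℚ.+ Σℚ (λ k → (Aq i k ℚ./ 1) ℚ.* xq k) ≡ (b i ℚ./ 1))
    × (∀ j → lz j ℤ.≤ xz j × xz j ℤ.≤ uz j)
    × (∀ k → (lq k ℚ./ 1) ℚ.≤ xq k × xq k ℚ.≤ (uq k ℚ./ 1))

  cost : Sol → ℚ
  cost (xz , xq) = Σℚ (λ j → (cz j ℚ./ 1) ℚ.* (xz j ℚ./ 1))
                   ℚ.+ Σℚ (λ k → (cq k ℚ./ 1) ℚ.* xq k)

  Optimal : Sol → Set
  Optimal x = Feasible x × (∀ y → Feasible y → cost x ℚ.≤ cost y)

  HasFractionality : ℕ → Set
  HasFractionality M =
    Σ Sol (λ x → Optimal x × maxDen (proj₂ x) ≡ M)
    × (∀ x → Optimal x → M ℕ.≤ maxDen (proj₂ x))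

  ISol : Set
  ISol = (Fin z → ℤ) × (Fin q → ℤ)

  IFeasible : ℕ → ISol → Set
  IFeasible K (zz , zq) =
    (∀ i → Σℤ (λ j → (ℤ.+ K ℤ.* Az i j) ℤ.* zz j)
             ℤ.+ Σℤ (λ k → Aq i k ℤ.* zq k) ≡ ℤ.+ K ℤ.* b i)
    × (∀ j → lz j ℤ.≤ zz j × zz j ℤ.≤ uz j)
    × (∀ k → ℤ.+ K ℤ.* lq k ℤ.≤ zq k × zq k ℤ.≤ ℤ.+ K ℤ.* uq k)

  icost : ℕ → ISol → ℤ
  icost K (zz , zq) = Σℤ (λ j → (ℤ.+ K ℤ.* cz j) ℤ.* zz j)
                      ℤ.+ Σℤ (λ k → cq k ℤ.* zq k)

  IOptimal : ℕ → ISol → Set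
  IOptimal K w = IFeasible K w × (∀ w' → IFeasible K w' → icost K w ℤ.≤ icost K w')

  unscale : (M : ℕ) → ISol → Sol
  unscale M (zz , zq) = zz , (λ k → _/_ (zq k) (M !) {{M !≢0}})

-- Scaling the continuous part by K maps an MILP-feasible point x with K·x_ℚ integral to an
-- IP-feasible point and back, multiplying the cost by K.  The unscaled IP optimum w is such a
-- point, with K·x_ℚ = w_ℚ; an optimum x* of fractionality M has all denominators ≤ M, hence
-- dividing K = M!, so K·x* is IP-feasible as well.  Therefore, for every feasible y,
-- K·cost(unscale w) = icost w ≤ icost(K·x*) = K·cost x* ≤ K·cost y.
module Submission where

open import Defs
open import Data.Nat as ℕ using (ℕ; zero; suc; NonZero; _!)
import Data.Nat.Properties as ℕ
open import Data.Nat.Divisibility using (_∣_; divides; ∣-trans; m∣m*n; m≤n⇒m!∣n!)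
import Data.Nat.Coprimality as Coprimality
open import Data.Integer as ℤ using (ℤ; +_)
import Data.Integer.Properties as ℤ
open import Data.Integer.Tactic.RingSolver using (solve-∀)
open import Data.Rational as ℚ using (ℚ; mkℚ; toℚᵘ)
import Data.Rational.Properties as ℚ
open import Data.Rational.Unnormalised as ℚᵘ using (mkℚᵘ; *≡*; *≤*)
import Data.Rational.Unnormalised.Properties as ℚᵘ
open import Data.Fin using (Fin; zero; suc)
open import Data.Product using (∃; _,_; proj₁; proj₂)
open import Relation.Binary.PropositionalEquality

m≤n⇒m∣n! : ∀ {m n} .{{_ : NonZero m}} → m ℕ.≤ n → m ∣ n !
m≤n⇒m∣n! {suc d} d<n = ∣-trans (m∣m*n (d !)) (m≤n⇒m!∣n! d<n)

↧ₙ≤maxDen : ∀ {n} (f : Fin n → ℚ) k → ℚ.↧ₙ (f k) ℕ.≤ maxDen f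
↧ₙ≤maxDen f zero    = ℕ.m≤m⊔n _ (maxDen (λ i → f (suc i)))
↧ₙ≤maxDen f (suc k) = ℕ.≤-trans (↧ₙ≤maxDen (λ i → f (suc i)) k) (ℕ.m≤n⊔m (ℚ.↧ₙ (f zero)) _)

fromℤ : ℤ → ℚ
fromℤ n = n ℚ./ 1

toℚᵘ-fromℤ : ∀ n → toℚᵘ (fromℤ n) ≡ mkℚᵘ n 0
toℚᵘ-fromℤ n = cong toℚᵘ (ℚ.↥p/↧p≡p (mkℚ n 0 (Coprimality.sym (Coprimality.1-coprimeTo _))))

fromℤ-homo-+ : ∀ a b → fromℤ (a ℤ.+ b) ≡ fromℤ a ℚ.+ fromℤ b
fromℤ-homo-+ a b = ℚ.toℚᵘ-injective (begin
  toℚᵘ (fromℤ (a ℤ.+ b))              ≡⟨ toℚᵘ-fromℤ (a ℤ.+ b) ⟩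
  mkℚᵘ (a ℤ.+ b) 0                    ≈⟨ *≡* (distrib a b) ⟩
  mkℚᵘ a 0 ℚᵘ.+ mkℚᵘ b 0              ≡⟨ sym (cong₂ ℚᵘ._+_ (toℚᵘ-fromℤ a) (toℚᵘ-fromℤ b)) ⟩
  toℚᵘ (fromℤ a) ℚᵘ.+ toℚᵘ (fromℤ b)  ≈⟨ ℚᵘ.≃-sym (ℚ.toℚᵘ-homo-+ (fromℤ a) (fromℤ b)) ⟩
  toℚᵘ (fromℤ a ℚ.+ fromℤ b)          ∎)
  where
  open ℚᵘ.≃-Reasoning
  distrib : ∀ a b → (a ℤ.+ b) ℤ.* ℤ.1ℤ ≡ (a ℤ.* ℤ.1ℤ ℤ.+ b ℤ.* ℤ.1ℤ) ℤ.* ℤ.1ℤ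
  distrib = solve-∀

fromℤ-homo-* : ∀ a b → fromℤ (a ℤ.* b) ≡ fromℤ a ℚ.* fromℤ b
fromℤ-homo-* a b = ℚ.toℚᵘ-injective (begin
  toℚᵘ (fromℤ (a ℤ.* b))              ≡⟨ toℚᵘ-fromℤ (a ℤ.* b) ⟩
  mkℚᵘ (a ℤ.* b) 0                    ≈⟨ *≡* refl ⟩
  mkℚᵘ a 0 ℚᵘ.* mkℚᵘ b 0              ≡⟨ sym (cong₂ ℚᵘ._*_ (toℚᵘ-fromℤ a) (toℚᵘ-fromℤ b)) ⟩
  toℚᵘ (fromℤ a) ℚᵘ.* toℚᵘ (fromℤ b)  ≈⟨ ℚᵘ.≃-sym (ℚ.toℚᵘ-homo-* (fromℤ a) (fromℤ b)) ⟩
  toℚᵘ (fromℤ a ℚ.* fromℤ b)          ∎)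
  where open ℚᵘ.≃-Reasoning

fromℤ-mono-≤ : ∀ {a b} → a ℤ.≤ b → fromℤ a ℚ.≤ fromℤ b
fromℤ-mono-≤ {a} {b} a≤b = ℚ.toℚᵘ-cancel-≤
  (subst₂ ℚᵘ._≤_ (sym (toℚᵘ-fromℤ a)) (sym (toℚᵘ-fromℤ b))
    (*≤* (subst₂ ℤ._≤_ (sym (ℤ.*-identityʳ a)) (sym (ℤ.*-identityʳ b)) a≤b)))

fromℤ-cancel-≤ : ∀ {a b} → fromℤ a ℚ.≤ fromℤ b → a ℤ.≤ b
fromℤ-cancel-≤ {a} {b} a≤b
  with subst₂ ℚᵘ._≤_ (toℚᵘ-fromℤ a) (toℚᵘ-fromℤ b) (ℚ.toℚᵘ-mono-≤ a≤b)
... | *≤* a*1≤b*1 = subst₂ ℤ._≤_ (ℤ.*-identityʳ a) (ℤ.*-identityʳ b) a*1≤b*1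

module _ (K : ℕ) .{{_ : NonZero K}} where

  κ : ℚ
  κ = fromℤ (+ K)

  private
    instance
      κ-pos : ℚ.Positive κ
      κ-pos = ℚ.normalize-pos K 1

      κ-nonNeg : ℚ.NonNegative κ
      κ-nonNeg = ℚ.pos⇒nonNeg κ

  record Scaled (a : ℤ) (p : ℚ) : Set where
    constructor scaled
    field fromℤ≡κ* : fromℤ a ≡ κ ℚ.* p

  Scaled-fromℤ : ∀ a → Scaled (+ K ℤ.* a) (fromℤ a)
  Scaled-fromℤ a = scaled (fromℤ-homo-* (+ K) a)

  Scaled-+ : ∀ {a b p q} → Scaled a p → Scaled b q → Scaled (a ℤ.+ b) (p ℚ.+ q)
  Scaled-+ {a} {b} {p} {q} (scaled a~p) (scaled b~q) = scaled (begin
    fromℤ (a ℤ.+ b)           ≡⟨ fromℤ-homo-+ a b ⟩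
    fromℤ a ℚ.+ fromℤ b       ≡⟨ cong₂ ℚ._+_ a~p b~q ⟩
    κ ℚ.* p ℚ.+ κ ℚ.* q       ≡⟨ ℚ.*-distribˡ-+ κ p q ⟨
    κ ℚ.* (p ℚ.+ q)           ∎)
    where open ≡-Reasoning

  Scaled-*ˡ : ∀ c {a p} → Scaled a p → Scaled (c ℤ.* a) (fromℤ c ℚ.* p)
  Scaled-*ˡ c {a} {p} (scaled a~p) = scaled (begin
    fromℤ (c ℤ.* a)           ≡⟨ fromℤ-homo-* c a ⟩
    fromℤ c ℚ.* fromℤ a       ≡⟨ cong (fromℤ c ℚ.*_) a~p ⟩
    fromℤ c ℚ.* (κ ℚ.* p)     ≡⟨ ℚ.*-assoc (fromℤ c) κ p ⟨
    (fromℤ c ℚ.* κ) ℚ.* p     ≡⟨ cong (ℚ._* p) (ℚ.*-comm (fromℤ c) κ) ⟩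
    (κ ℚ.* fromℤ c) ℚ.* p     ≡⟨ ℚ.*-assoc κ (fromℤ c) p ⟩
    κ ℚ.* (fromℤ c ℚ.* p)     ∎)
    where open ≡-Reasoning

  Scaled-*ʳ : ∀ c {a p} → Scaled a p → Scaled (a ℤ.* c) (p ℚ.* fromℤ c)
  Scaled-*ʳ c {a} {p} (scaled a~p) = scaled (begin
    fromℤ (a ℤ.* c)           ≡⟨ fromℤ-homo-* a c ⟩
    fromℤ a ℚ.* fromℤ c       ≡⟨ cong (ℚ._* fromℤ c) a~p ⟩
    (κ ℚ.* p) ℚ.* fromℤ c     ≡⟨ ℚ.*-assoc κ p (fromℤ c) ⟩
    κ ℚ.* (p ℚ.* fromℤ c)     ∎)
    where open ≡-Reasoning

  Scaled-Σ : ∀ {n} {f : Fin n → ℤ} {g : Fin n → ℚ} →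
             (∀ i → Scaled (f i) (g i)) → Scaled (Σℤ f) (Σℚ g)
  Scaled-Σ {zero}  f~g = scaled (sym (ℚ.*-zeroʳ κ))
  Scaled-Σ {suc n} f~g = Scaled-+ (f~g zero) (Scaled-Σ (λ i → f~g (suc i)))

  Scaled-linearForm : ∀ {z q} (a : Fin z → ℤ) (c : Fin q → ℤ) (xz : Fin z → ℤ)
                        {zq : Fin q → ℤ} {xq : Fin q → ℚ} →
    (∀ k → Scaled (zq k) (xq k)) →
    Scaled (Σℤ (λ j → (+ K ℤ.* a j) ℤ.* xz j) ℤ.+ Σℤ (λ k → c k ℤ.* zq k))
           (Σℚ (λ j → fromℤ (a j) ℚ.* fromℤ (xz j)) ℚ.+ Σℚ (λ k → fromℤ (c k) ℚ.* xq k))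
  Scaled-linearForm a c xz zq~xq =
    Scaled-+ (Scaled-Σ (λ j → Scaled-*ʳ (xz j) (Scaled-fromℤ (a j))))
             (Scaled-Σ (λ k → Scaled-*ˡ (c k) (zq~xq k)))

  Scaled-reflects-≤ : ∀ {a b p q} → Scaled a p → Scaled b q → a ℤ.≤ b → p ℚ.≤ q
  Scaled-reflects-≤ (scaled a~p) (scaled b~q) a≤b =
    ℚ.*-cancelˡ-≤-pos κ (subst₂ ℚ._≤_ a~p b~q (fromℤ-mono-≤ a≤b))

  Scaled-preserves-≤ : ∀ {a b p q} → Scaled a p → Scaled b q → p ℚ.≤ q → a ℤ.≤ b
  Scaled-preserves-≤ (scaled a~p) (scaled b~q) p≤q =
    fromℤ-cancel-≤ (subst₂ ℚ._≤_ (sym a~p) (sym b~q) (ℚ.*-monoˡ-≤-nonNeg κ p≤q))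

  Scaled-reflects-≡ : ∀ {a b p q} → Scaled a p → Scaled b q → a ≡ b → p ≡ q
  Scaled-reflects-≡ a~p b~q a≡b = ℚ.≤-antisym
    (Scaled-reflects-≤ a~p b~q (ℤ.≤-reflexive a≡b))
    (Scaled-reflects-≤ b~q a~p (ℤ.≤-reflexive (sym a≡b)))

  Scaled-preserves-≡ : ∀ {a b p q} → Scaled a p → Scaled b q → p ≡ q → a ≡ b
  Scaled-preserves-≡ a~p b~q p≡q = ℤ.≤-antisym
    (Scaled-preserves-≤ a~p b~q (ℚ.≤-reflexive p≡q))
    (Scaled-preserves-≤ b~q a~p (ℚ.≤-reflexive (sym p≡q)))

Scaled-/ : ∀ K .{{_ : NonZero K}} n → Scaled K n (n ℚ./ K)
Scaled-/ (suc k) n = scaled (ℚ.toℚᵘ-injective (begin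
  toℚᵘ (fromℤ n)                                   ≡⟨ toℚᵘ-fromℤ n ⟩
  mkℚᵘ n 0                                         ≈⟨ *≡* cross ⟩
  mkℚᵘ (+ suc k) 0 ℚᵘ.* mkℚᵘ n k                   ≈⟨ ℚᵘ.*-cong (ℚᵘ.≃-reflexive (sym (toℚᵘ-fromℤ (+ suc k))))
                                                                 (ℚᵘ.≃-sym (ℚ.toℚᵘ-fromℚᵘ (mkℚᵘ n k))) ⟩
  toℚᵘ (fromℤ (+ suc k)) ℚᵘ.* toℚᵘ (n ℚ./ suc k)   ≈⟨ ℚᵘ.≃-sym (ℚ.toℚᵘ-homo-* (fromℤ (+ suc k)) (n ℚ./ suc k)) ⟩
  toℚᵘ (fromℤ (+ suc k) ℚ.* (n ℚ./ suc k))         ∎))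
  where
  open ℚᵘ.≃-Reasoning
  commute : ∀ n s → n ℤ.* (ℤ.1ℤ ℤ.* s) ≡ (s ℤ.* n) ℤ.* ℤ.1ℤ
  commute = solve-∀
  cross : n ℤ.* + (1 ℕ.* suc k) ≡ (+ suc k ℤ.* n) ℤ.* ℤ.1ℤ
  cross = trans (cong (n ℤ.*_) (ℤ.pos-* 1 (suc k))) (commute n (+ suc k))

Scaled-integral : ∀ K .{{_ : NonZero K}} p → ℚ.↧ₙ p ∣ K → ∃ λ n → Scaled K n p
Scaled-integral _ p@(mkℚ np d _) (divides e refl) = np ℤ.* + e , scaled (ℚ.toℚᵘ-injective (begin
  toℚᵘ (fromℤ (np ℤ.* + e))          ≡⟨ toℚᵘ-fromℤ (np ℤ.* + e) ⟩
  mkℚᵘ (np ℤ.* + e) 0                ≈⟨ *≡* cross ⟩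
  mkℚᵘ (+ K) 0 ℚᵘ.* toℚᵘ p           ≡⟨ cong (ℚᵘ._* toℚᵘ p) (toℚᵘ-fromℤ (+ K)) ⟨
  toℚᵘ (fromℤ (+ K)) ℚᵘ.* toℚᵘ p     ≈⟨ ℚᵘ.≃-sym (ℚ.toℚᵘ-homo-* (fromℤ (+ K)) p) ⟩
  toℚᵘ (fromℤ (+ K) ℚ.* p)           ∎))
  where
  open ℚᵘ.≃-Reasoning
  K : ℕ
  K = e ℕ.* suc d
  commute : ∀ n e s → (n ℤ.* e) ℤ.* (ℤ.1ℤ ℤ.* s) ≡ ((e ℤ.* s) ℤ.* n) ℤ.* ℤ.1ℤ
  commute = solve-∀
  cross : (np ℤ.* + e) ℤ.* + (1 ℕ.* suc d) ≡ (+ K ℤ.* np) ℤ.* ℤ.1ℤ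
  cross = trans (cong ((np ℤ.* + e) ℤ.*_) (ℤ.pos-* 1 (suc d)))
         (trans (commute np (+ e) (+ suc d))
                (cong (λ t → (t ℤ.* np) ℤ.* ℤ.1ℤ) (sym (ℤ.pos-* e (suc d)))))

module _ {m z q} (P : MILP m z q) (K : ℕ) .{{_ : NonZero K}} where
  open MILP P

  IFeasible⇒Feasible : ∀ {xz zq xq} → (∀ k → Scaled K (zq k) (xq k)) →
                       IFeasible P K (xz , zq) → Feasible P (xz , xq)
  IFeasible⇒Feasible {xz} zq~xq (rows , boundsz , boundsq) =
    (λ i → Scaled-reflects-≡ K (Scaled-linearForm K (Az i) (Aq i) xz zq~xq)
                               (Scaled-fromℤ K (b i)) (rows i))
    , boundsz
    , λ k → Scaled-reflects-≤ K (Scaled-fromℤ K (lq k)) (zq~xq k) (proj₁ (boundsq k))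
          , Scaled-reflects-≤ K (zq~xq k) (Scaled-fromℤ K (uq k)) (proj₂ (boundsq k))

  Feasible⇒IFeasible : ∀ {xz zq xq} → (∀ k → Scaled K (zq k) (xq k)) →
                       Feasible P (xz , xq) → IFeasible P K (xz , zq)
  Feasible⇒IFeasible {xz} zq~xq (rows , boundsz , boundsq) =
    (λ i → Scaled-preserves-≡ K (Scaled-linearForm K (Az i) (Aq i) xz zq~xq)
                                (Scaled-fromℤ K (b i)) (rows i))
    , boundsz
    , λ k → Scaled-preserves-≤ K (Scaled-fromℤ K (lq k)) (zq~xq k) (proj₁ (boundsq k))
          , Scaled-preserves-≤ K (zq~xq k) (Scaled-fromℤ K (uq k)) (proj₂ (boundsq k))

  Scaled-icost : ∀ {xz zq xq} → (∀ k → Scaled K (zq k) (xq k)) →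
                 Scaled K (icost P K (xz , zq)) (cost P (xz , xq))
  Scaled-icost {xz} = Scaled-linearForm K cz cq xz

lemma4 : ∀ {m z q} (P : MILP m z q) (M : ℕ) →
    HasFractionality P M →
    ∀ w → IOptimal P (M !) w →
    Optimal P (unscale P M w)
lemma4 P M (((xz , xq) , (x-feasible , x-minimal) , maxDen≡M) , _) (wz , wq) (w-feasible , w-minimal) =
  IFeasible⇒Feasible P K wq~w/K w-feasible , unscale-minimal
  where
  K : ℕ
  K = M !

  instance
    K-nonZero : NonZero K
    K-nonZero = M ℕ.!≢0

  wq~w/K : ∀ k → Scaled K (wq k) (wq k ℚ./ K)
  wq~w/K k = Scaled-/ K (wq k)

  Kxq-integral : ∀ k → ∃ λ n → Scaled K n (xq k)
  Kxq-integral k = Scaled-integral K (xq k)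
    (m≤n⇒m∣n! (subst (ℚ.↧ₙ (xq k) ℕ.≤_) maxDen≡M (↧ₙ≤maxDen xq k)))

  Kxq : Fin _ → ℤ
  Kxq k = proj₁ (Kxq-integral k)

  Kxq~xq : ∀ k → Scaled K (Kxq k) (xq k)
  Kxq~xq k = proj₂ (Kxq-integral k)

  unscale-minimal : ∀ y → Feasible P y → cost P (wz , λ k → wq k ℚ./ K) ℚ.≤ cost P y
  unscale-minimal y y-feasible = ℚ.≤-trans
    (Scaled-reflects-≤ K (Scaled-icost P K wq~w/K) (Scaled-icost P K Kxq~xq)
      (w-minimal (xz , Kxq) (Feasible⇒IFeasible P K Kxq~xq x-feasible)))
    (x-minimal y y-feasible)
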